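{- Let $r\geq 2$ and let $d_1,d_2,\dots,d_r$ be an ordered sequence of $r$ distinct integers with $d_i\geq 2$ for $i=1,\dots,r$. Then there exist an integer $n$ and $r$ graphs $G_1,G_2,\dots,G_r$, each of order $n$, such that for every $1\leq i\leq r$ the graph $G_i$ contains a clique $K_{d_i}$ and $D(G_i)=d_i$.
   Context: All graphs are finite, simple, loopless and undirected. For a graph $G$, an $r$-labeling $c:V(G)\to\{1,\dots,r\}$ is $r$-distinguishing if for every automorphism $\sigma\neq \mathrm{id}$ of $G$ we have $c\neq c\circ\sigma$. The distinguishing number $D(G)$ is the smallest $r$ such that $G$ has an $r$-distinguishing labeling. $K_d$ denotes the complete graph on $d$ vertices. -}

module Defs where

open import Data.Nat using (ℕ; _<_)
open import Data.Fin using (Fin)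
open import Data.Fin.Permutation using (Permutation′; _⟨$⟩ʳ_)
open import Data.Product using (Σ; _×_)
open import Relation.Binary.PropositionalEquality using (_≡_; _≢_)
open import Relation.Nullary using (¬_)

record Graph (n : ℕ) : Set₁ where
  field
    Adj      : Fin n → Fin n → Set
    sym      : ∀ {u v} → Adj u v → Adj v u
    loopless : ∀ {v} → ¬ Adj v v
open Graph public

IsAutomorphism : {n : ℕ} → Graph n → Permutation′ n → Set
IsAutomorphism G σ =
  ∀ u v → (Adj G u v → Adj G (σ ⟨$⟩ʳ u) (σ ⟨$⟩ʳ v))
        × (Adj G (σ ⟨$⟩ʳ u) (σ ⟨$⟩ʳ v) → Adj G u v)

IsDistinguishing : {n r : ℕ} → Graph n → (Fin n → Fin r) → Set
IsDistinguishing G c =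
  ∀ σ → IsAutomorphism G σ →
    ¬ (∀ v → σ ⟨$⟩ʳ v ≡ v) →
    ¬ (∀ v → c v ≡ c (σ ⟨$⟩ʳ v))

HasDistinguishingLabeling : {n : ℕ} → Graph n → ℕ → Set
HasDistinguishingLabeling {n} G r = Σ (Fin n → Fin r) (IsDistinguishing G)

DistinguishingNumberIs : {n : ℕ} → Graph n → ℕ → Set
DistinguishingNumberIs G d =
  HasDistinguishingLabeling G d × (∀ r → r < d → ¬ HasDistinguishingLabeling G r)

ContainsClique : {n : ℕ} → Graph n → ℕ → Set
ContainsClique {n} G d =
  Σ (Fin d → Fin n) λ f →
    (∀ i j → f i ≡ f j → i ≡ j) × (∀ i j → i ≢ j → Adj G (f i) (f j))

-- Take G = K_d ⊔ P_m, a clique on the vertices 0, …, d-1 next to a path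
-- d — d+1 — ⋯ — n-1 with at least three vertices; the common order is n = 3 + max dᵢ.
-- Any two clique vertices are twins, so their transposition is an automorphism; a
-- labeling with fewer than d labels repeats a label on the clique (pigeonhole) and is
-- therefore not distinguishing.  Conversely, label clique vertex k by k, the first
-- path vertex d by 1 and the rest of the path by 0.  A label-preserving automorphism
-- must fix d: otherwise it sends d to clique vertex 1, and then both d+1 and d+2 to
-- clique vertex 0.  Once d is fixed, the labels fix the clique and adjacency fixes
-- the path vertex by vertex.
module Submission where

open import Defs hiding (sym)
open import Data.Nat using (ℕ; zero; suc; _+_; _∸_; _≤_; _<_; z≤n; s≤s; _<?_)
open import Data.Nat.Properties
  using (<-cmp; <-irrefl; <-asym; <⇒≢; <⇒≱; ≤-trans; ≤-refl; n≤1+n; n<1+n; m≤m+n;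
         m≤n+m; +-suc; +-identityʳ; +-monoʳ-≤; +-monoʳ-<; suc-injective; 0≢1+n; 1+n≢n;
         ≮⇒≥; m+[n∸m]≡n)
open import Data.Fin as Fin using (Fin; toℕ; fromℕ<; inject≤)
open import Data.Fin.Properties
  using (toℕ-injective; toℕ-fromℕ<; fromℕ<-injective; toℕ-inject≤; inject≤-injective;
         toℕ<n; pigeonhole)
open import Data.Fin.Permutation
  using (Permutation′; _⟨$⟩ʳ_; _⟨$⟩ˡ_; inverseˡ; transpose)
import Data.Fin.Permutation.Components as PC
open import Data.List using (tabulate)
open import Data.List.Extrema.Nat using (max; xs≤max)
open import Data.List.Relation.Unary.All.Properties using (tabulate⁻)
open import Data.Product using (Σ; _×_; _,_; proj₁)
open import Data.Sum using (_⊎_; inj₁; inj₂)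
open import Data.Empty using (⊥-elim)
open import Relation.Binary.Definitions using (tri<; tri≈; tri>)
open import Relation.Binary.PropositionalEquality
open import Relation.Nullary using (¬_; yes; no)

Twins : ∀ {n} → Graph n → Fin n → Fin n → Set
Twins G u v = ∀ w → w ≢ u → w ≢ v → Adj G u w → Adj G v w

data TransposeView {n} (i j : Fin n) : Fin n → Fin n → Set where
  at-i : TransposeView i j i j
  at-j : TransposeView i j j i
  away : ∀ {k} → k ≢ i → k ≢ j → TransposeView i j k k

transpose-view : ∀ {n} (i j k : Fin n) → TransposeView i j k (PC.transpose i j k)
transpose-view i j k with k Fin.≟ i
... | yes refl = at-i
... | no k≢i with k Fin.≟ j
...   | yes refl = at-j
...   | no k≢j = away k≢i k≢j

module _ {n} (G : Graph n) {u v : Fin n} (u~v : Twins G u v) (v~u : Twins G v u) where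

  transpose-preserves-Adj : ∀ x y → Adj G x y →
    Adj G (PC.transpose u v x) (PC.transpose u v y)
  transpose-preserves-Adj x y
    with PC.transpose u v x | transpose-view u v x
       | PC.transpose u v y | transpose-view u v y
  ... | _ | at-i           | _ | at-i           = λ uu → ⊥-elim (loopless G uu)
  ... | _ | at-i           | _ | at-j           = Graph.sym G
  ... | _ | at-i           | _ | away y≢u y≢v   = u~v y y≢u y≢v
  ... | _ | at-j           | _ | at-i           = Graph.sym G
  ... | _ | at-j           | _ | at-j           = λ vv → ⊥-elim (loopless G vv)
  ... | _ | at-j           | _ | away y≢u y≢v   = v~u y y≢v y≢u
  ... | _ | away x≢u x≢v   | _ | at-i           =
    λ xu → Graph.sym G (u~v x x≢u x≢v (Graph.sym G xu))
  ... | _ | away x≢u x≢v   | _ | at-j           =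
    λ xv → Graph.sym G (v~u x x≢v x≢u (Graph.sym G xv))
  ... | _ | away _ _       | _ | away _ _       = λ xy → xy

module _ {n} {G : Graph n} {u v : Fin n} where

  transpose-isAutomorphism : Twins G u v → Twins G v u → IsAutomorphism G (transpose u v)
  transpose-isAutomorphism u~v v~u x y =
      transpose-preserves-Adj G u~v v~u x y
    , λ τxτy → subst₂ (Adj G) (PC.transpose-inverse v u) (PC.transpose-inverse v u)
                 (transpose-preserves-Adj G v~u u~v _ _ τxτy)

  twins-sameLabel⇒¬distinguishing : ∀ {r} {c : Fin n → Fin r} → u ≢ v →
    Twins G u v → Twins G v u → c u ≡ c v → ¬ IsDistinguishing G c
  twins-sameLabel⇒¬distinguishing {c = c} u≢v u~v v~u cu≡cv distinguishing =
    distinguishing (transpose u v) (transpose-isAutomorphism u~v v~u) moves-u preserves-c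
    where
    moves-u : ¬ (∀ w → transpose u v ⟨$⟩ʳ w ≡ w)
    moves-u fixes-all with PC.transpose u v u | transpose-view u v u | fixes-all u
    ... | _ | at-i | v≡u = u≢v (sym v≡u)
    ... | _ | at-j | refl = u≢v refl
    ... | _ | away u≢u _ | _ = u≢u refl

    preserves-c : ∀ w → c w ≡ c (transpose u v ⟨$⟩ʳ w)
    preserves-c w with PC.transpose u v w | transpose-view u v w
    ... | _ | at-i = cu≡cv
    ... | _ | at-j = sym cu≡cv
    ... | _ | away _ _ = refl

twinFamily⇒¬distinguishing : ∀ {n d} {G : Graph n} (f : Fin d → Fin n) →
  (∀ i j → f i ≡ f j → i ≡ j) → (∀ i j → Twins G (f i) (f j)) →
  ∀ r → r < d → ¬ HasDistinguishingLabeling G r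
twinFamily⇒¬distinguishing {G = G} f f-injective twins r r<d (c , distinguishing)
  with i , j , i<j , cfi≡cfj ← pigeonhole r<d (λ i → c (f i)) =
  twins-sameLabel⇒¬distinguishing {G = G}
    (λ fi≡fj → Data.Fin.Properties.<⇒≢ i<j (f-injective i j fi≡fj))
    (twins i j) (twins j i) cfi≡cfj distinguishing

module CliqueAndPath (d : ℕ) where

  data Link : ℕ → ℕ → Set where
    clique : ∀ {a b} → a < d → b < d → a ≢ b → Link a b
    path   : ∀ {a} → d ≤ a → Link a (suc a)
    path⁻¹ : ∀ {a} → d ≤ a → Link (suc a) a

  link-sym : ∀ {a b} → Link a b → Link b a
  link-sym (clique a<d b<d a≢b) = clique b<d a<d (λ b≡a → a≢b (sym b≡a))
  link-sym (path d≤a) = path⁻¹ d≤a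
  link-sym (path⁻¹ d≤a) = path d≤a

  link-irrefl : ∀ {a} → ¬ Link a a
  link-irrefl (clique _ _ a≢a) = a≢a refl

  link-from-clique : ∀ {a b} → Link a b → a < d → b < d
  link-from-clique (clique _ b<d _) _ = b<d
  link-from-clique (path d≤a) a<d = ⊥-elim (<⇒≱ a<d d≤a)
  link-from-clique (path⁻¹ d≤a) a+1<d = ⊥-elim (<⇒≱ a+1<d (≤-trans d≤a (n≤1+n _)))

  link-beyond-clique : ∀ {a b} → Link a b → d ≤ a → b ≡ suc a ⊎ (d ≤ b × suc b ≡ a)
  link-beyond-clique (clique a<d _ _) d≤a = ⊥-elim (<⇒≱ a<d d≤a)
  link-beyond-clique (path _) _ = inj₁ refl
  link-beyond-clique (path⁻¹ d≤b) _ = inj₂ (d≤b , refl)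

  link-along-path : ∀ j {b} → Link (d + j) b →
    b ≡ d + suc j ⊎ Σ ℕ λ i → j ≡ suc i × b ≡ d + i
  link-along-path j link with link-beyond-clique link (m≤m+n d j)
  ... | inj₁ b≡1+d+j = inj₁ (trans b≡1+d+j (sym (+-suc d j)))
  link-along-path zero {b} _ | inj₂ (d≤b , 1+b≡d+0) =
    ⊥-elim (<⇒≱ (subst (b <_) (+-identityʳ d) (subst (suc b ≤_) 1+b≡d+0 ≤-refl)) d≤b)
  link-along-path (suc i) _ | inj₂ (_ , 1+b≡d+1+i) =
    inj₂ (i , refl , suc-injective (trans 1+b≡d+1+i (+-suc d i)))

  graph : (n : ℕ) → Graph n
  graph n = record
    { Adj      = λ u v → Link (toℕ u) (toℕ v)
    ; sym      = link-sym
    ; loopless = link-irrefl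
    }

  cliqueVertex : ∀ {n} → d ≤ n → Fin d → Fin n
  cliqueVertex d≤n i = inject≤ i d≤n

  cliqueVertex<d : ∀ {n} (d≤n : d ≤ n) i → toℕ (cliqueVertex d≤n i) < d
  cliqueVertex<d d≤n i = subst (_< d) (sym (toℕ-inject≤ i d≤n)) (toℕ<n i)

  graph-containsClique : ∀ {n} → d ≤ n → ContainsClique (graph n) d
  graph-containsClique d≤n =
      cliqueVertex d≤n
    , inject≤-injective d≤n d≤n
    , λ i j i≢j → clique (cliqueVertex<d d≤n i) (cliqueVertex<d d≤n j)
        (λ e → i≢j (inject≤-injective d≤n d≤n i j (toℕ-injective e)))

  clique-twins : ∀ {n} {u v : Fin n} → toℕ u < d → toℕ v < d → Twins (graph n) u v
  clique-twins u<d v<d w _ w≢v u~w =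
    clique v<d (link-from-clique u~w u<d) (λ v≡w → w≢v (toℕ-injective (sym v≡w)))

  graph-¬distinguishing : ∀ {n} → d ≤ n →
    ∀ r → r < d → ¬ HasDistinguishingLabeling (graph n) r
  graph-¬distinguishing {n} d≤n =
    twinFamily⇒¬distinguishing {G = graph n} (cliqueVertex d≤n) (inject≤-injective d≤n d≤n)
      (λ i j → clique-twins (cliqueVertex<d d≤n i) (cliqueVertex<d d≤n j))

  module Labeling (2≤d : 2 ≤ d) where

    label : ℕ → ℕ
    label k with <-cmp k d
    ... | tri< _ _ _ = k
    ... | tri≈ _ _ _ = 1
    ... | tri> _ _ _ = 0

    label<d : ∀ k → label k < d
    label<d k with <-cmp k d
    ... | tri< k<d _ _ = k<d
    ... | tri≈ _ _ _ = 2≤d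
    ... | tri> _ _ _ = ≤-trans (n≤1+n 1) 2≤d

    label-clique : ∀ {k} → k < d → label k ≡ k
    label-clique {k} k<d with <-cmp k d
    ... | tri< _ _ _ = refl
    ... | tri≈ _ k≡d _ = ⊥-elim (<⇒≢ k<d k≡d)
    ... | tri> _ _ k>d = ⊥-elim (<-asym k<d k>d)

    label-d : label d ≡ 1
    label-d with <-cmp d d
    ... | tri< d<d _ _ = ⊥-elim (<-irrefl refl d<d)
    ... | tri≈ _ _ _ = refl
    ... | tri> _ _ d>d = ⊥-elim (<-irrefl refl d>d)

    label-path : ∀ {k} → d < k → label k ≡ 0
    label-path {k} k>d with <-cmp k d
    ... | tri< k<d _ _ = ⊥-elim (<-asym k<d k>d)
    ... | tri≈ _ k≡d _ = ⊥-elim (<⇒≢ k>d (sym k≡d))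
    ... | tri> _ _ _ = refl

    label≡1 : ∀ {k} → label k ≡ 1 → k ≡ 1 ⊎ k ≡ d
    label≡1 {k} e with <-cmp k d
    ... | tri< _ _ _ = inj₁ e
    ... | tri≈ _ k≡d _ = inj₂ k≡d
    ... | tri> _ _ _ = ⊥-elim (0≢1+n e)

    label≡2+ : ∀ {k m} → 2 ≤ m → label k ≡ m → k ≡ m
    label≡2+ {k} 2≤m e with <-cmp k d
    ... | tri< _ _ _ = e
    ... | tri≈ _ _ _ = ⊥-elim (<⇒≢ 2≤m e)
    ... | tri> _ _ _ = ⊥-elim (<⇒≢ (≤-trans (n≤1+n 1) 2≤m) e)

    labeling : ∀ {n} → Fin n → Fin d
    labeling v = fromℕ< (label<d (toℕ v))

    module Rigidity {n} (3+d≤n : 3 + d ≤ n) (σ : Permutation′ n)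
      (σ-automorphism : IsAutomorphism (graph n) σ)
      (σ-preserves-labeling : ∀ v → labeling v ≡ labeling (σ ⟨$⟩ʳ v)) where

      s : Fin n → ℕ
      s v = toℕ (σ ⟨$⟩ʳ v)

      s-link : ∀ {u v} → Link (toℕ u) (toℕ v) → Link (s u) (s v)
      s-link {u} {v} = proj₁ (σ-automorphism u v)

      s-injective : ∀ {u v} → s u ≡ s v → toℕ u ≡ toℕ v
      s-injective {u} {v} su≡sv = cong toℕ (begin
        u                  ≡⟨ inverseˡ σ ⟨
        σ ⟨$⟩ˡ (σ ⟨$⟩ʳ u)  ≡⟨ cong (σ ⟨$⟩ˡ_) (toℕ-injective su≡sv) ⟩
        σ ⟨$⟩ˡ (σ ⟨$⟩ʳ v)  ≡⟨ inverseˡ σ ⟩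
        v                  ∎)
        where open ≡-Reasoning

      s-label : ∀ v {k} → toℕ v ≡ k → label (s v) ≡ label k
      s-label v refl =
        sym (fromℕ<-injective _ _ (label<d (toℕ v)) (label<d (s v)) (σ-preserves-labeling v))

      s-next-to-clique : ∀ {u v} → Link (toℕ u) (toℕ v) → s u < d →
        s v ≡ label (toℕ v)
      s-next-to-clique u~v su<d =
        trans (sym (label-clique (link-from-clique (s-link u~v) su<d))) (s-label _ refl)

      index<n : ∀ (v : Fin n) {k m} → toℕ v ≡ k → m ≤ k → m < n
      index<n v refl m≤k = ≤-trans (s≤s m≤k) (toℕ<n v)

      path-link : ∀ (u v : Fin n) {a} → d ≤ a → toℕ u ≡ a → toℕ v ≡ suc a →
        Link (toℕ u) (toℕ v)
      path-link u v d≤a refl v≡1+a rewrite v≡1+a = path d≤a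

      Fixes : ℕ → Set
      Fixes k = ∀ v → toℕ v ≡ k → s v ≡ k

      s-hits-fixed : ∀ {k v} → k < n → Fixes k → s v ≡ k → toℕ v ≡ k
      s-hits-fixed {k} k<n fixes-k sv≡k = trans (s-injective (trans sv≡k (sym (fixes-k _ tk)))) tk
        where
        tk : toℕ (fromℕ< k<n) ≡ k
        tk = toℕ-fromℕ< k<n

      0<d : 0 < d
      0<d = ≤-trans (n≤1+n 1) 2≤d

      d<n : d < n
      d<n = ≤-trans (n≤1+n _) (≤-trans (n≤1+n _) 3+d≤n)

      fixes-d : Fixes d
      fixes-d v v≡d with label≡1 (trans (s-label v v≡d) label-d)
      ... | inj₂ sv≡d = sv≡d
      ... | inj₁ sv≡1 = ⊥-elim (1+n≢n (sym collision))
        where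
        open ≡-Reasoning
        1+d<n : suc d < n
        1+d<n = ≤-trans (n≤1+n _) 3+d≤n
        u₁ u₂ : Fin n
        u₁ = fromℕ< 1+d<n
        u₂ = fromℕ< 3+d≤n
        t₁ : toℕ u₁ ≡ suc d
        t₁ = toℕ-fromℕ< 1+d<n
        t₂ : toℕ u₂ ≡ suc (suc d)
        t₂ = toℕ-fromℕ< 3+d≤n
        s₁≡0 : s u₁ ≡ 0
        s₁≡0 = begin
          s u₁            ≡⟨ s-next-to-clique (path-link v u₁ ≤-refl v≡d t₁)
                                              (subst (_< d) (sym sv≡1) 2≤d) ⟩
          label (toℕ u₁) ≡⟨ cong label t₁ ⟩
          label (suc d)  ≡⟨ label-path (n<1+n d) ⟩
          0               ∎
        s₂≡0 : s u₂ ≡ 0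
        s₂≡0 = begin
          s u₂                 ≡⟨ s-next-to-clique (path-link u₁ u₂ (n≤1+n d) t₁ t₂)
                                                   (subst (_< d) (sym s₁≡0) 0<d) ⟩
          label (toℕ u₂)      ≡⟨ cong label t₂ ⟩
          label (suc (suc d)) ≡⟨ label-path (n≤1+n (suc d)) ⟩
          0                    ∎
        collision : suc d ≡ suc (suc d)
        collision = begin
          suc d        ≡⟨ t₁ ⟨
          toℕ u₁       ≡⟨ s-injective (trans s₁≡0 (sym s₂≡0)) ⟩
          toℕ u₂       ≡⟨ t₂ ⟩
          suc (suc d)  ∎

      fixes-1 : Fixes 1
      fixes-1 v v≡1 with label≡1 (trans (s-label v v≡1) (label-clique 2≤d))
      ... | inj₁ sv≡1 = sv≡1
      ... | inj₂ sv≡d =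
        ⊥-elim (<⇒≢ 2≤d (trans (sym v≡1) (s-hits-fixed d<n fixes-d sv≡d)))

      fixes-0 : Fixes 0
      fixes-0 v v≡0 = begin
        s v             ≡⟨ s-next-to-clique w~v (subst (_< d) (sym (fixes-1 w tw)) 2≤d) ⟩
        label (toℕ v)  ≡⟨ cong label v≡0 ⟩
        label 0        ≡⟨ label-clique 0<d ⟩
        0               ∎
        where
        open ≡-Reasoning
        1<n : 1 < n
        1<n = ≤-trans 2≤d (≤-trans (n≤1+n d) d<n)
        w : Fin n
        w = fromℕ< 1<n
        tw : toℕ w ≡ 1
        tw = toℕ-fromℕ< 1<n
        w~v : Link (toℕ w) (toℕ v)
        w~v rewrite tw | v≡0 = clique 2≤d 0<d (λ ())

      fixes-clique : ∀ {k} → 2 ≤ k → k < d → Fixes k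
      fixes-clique 2≤k k<d v v≡k =
        label≡2+ 2≤k (trans (s-label v v≡k) (label-clique k<d))

      fixes-path-next : ∀ j → Fixes (d + j) → (∀ {i} → j ≡ suc i → Fixes (d + i)) →
        Fixes (d + suc j)
      fixes-path-next j fixes-d+j fixes-d+i v v≡d+1+j
        with link-along-path j (subst (λ a → Link a (s v)) (fixes-d+j u tu) (s-link u~v))
        where
        d+j<n : d + j < n
        d+j<n = index<n v v≡d+1+j (+-monoʳ-≤ d (n≤1+n j))
        u : Fin n
        u = fromℕ< d+j<n
        tu : toℕ u ≡ d + j
        tu = toℕ-fromℕ< d+j<n
        u~v : Link (toℕ u) (toℕ v)
        u~v = path-link u v (m≤m+n d j) tu (trans v≡d+1+j (+-suc d j))
      ... | inj₁ sv≡d+1+j = sv≡d+1+j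
      ... | inj₂ (i , refl , sv≡d+i) =
        ⊥-elim (<⇒≢ (+-monoʳ-< d (n≤1+n (suc i)))
                    (trans (sym (s-hits-fixed d+i<n (fixes-d+i refl) sv≡d+i)) v≡d+1+j))
        where
        d+i<n : d + i < n
        d+i<n = index<n v v≡d+1+j (+-monoʳ-≤ d (≤-trans (n≤1+n i) (n≤1+n _)))

      fixes-path : ∀ j → Fixes (d + j)
      fixes-path zero = subst Fixes (sym (+-identityʳ d)) fixes-d
      fixes-path (suc j) = fixes-path-next j (fixes-path j) λ { refl → fixes-path _ }

      fixes : ∀ k → Fixes k
      fixes zero = fixes-0
      fixes (suc zero) = fixes-1
      fixes k@(suc (suc _)) with k <? d
      ... | yes k<d = fixes-clique (s≤s (s≤s z≤n)) k<d
      ... | no k≮d = subst Fixes (m+[n∸m]≡n (≮⇒≥ k≮d)) (fixes-path (k ∸ d))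

      σ-fixes-all : ∀ v → σ ⟨$⟩ʳ v ≡ v
      σ-fixes-all v = toℕ-injective (fixes (toℕ v) v refl)

    labeling-distinguishing : ∀ {n} → 3 + d ≤ n → IsDistinguishing (graph n) labeling
    labeling-distinguishing 3+d≤n σ σ-automorphism σ-moves σ-preserves-labeling =
      σ-moves (Rigidity.σ-fixes-all 3+d≤n σ σ-automorphism σ-preserves-labeling)

  graph-distinguishingNumber : ∀ {n} → 2 ≤ d → 3 + d ≤ n →
    DistinguishingNumberIs (graph n) d
  graph-distinguishingNumber 2≤d 3+d≤n =
      (Labeling.labeling 2≤d , Labeling.labeling-distinguishing 2≤d 3+d≤n)
    , graph-¬distinguishing (≤-trans (m≤n+m d 3) 3+d≤n)

proposition1 : (r : ℕ) → 2 ≤ r → (d : Fin r → ℕ) →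
    (∀ i j → d i ≡ d j → i ≡ j) → (∀ i → 2 ≤ d i) →
    Σ ℕ λ n → Σ (Fin r → Graph n) λ G →
      ∀ i → ContainsClique (G i) (d i) × DistinguishingNumberIs (G i) (d i)
proposition1 r _ d _ 2≤d = 3 + dₘₐₓ , (λ i → graph (d i) (3 + dₘₐₓ)) , λ i →
    graph-containsClique (d i) (≤-trans (d≤dₘₐₓ i) (m≤n+m dₘₐₓ 3))
  , graph-distinguishingNumber (d i) (2≤d i) (+-monoʳ-≤ 3 (d≤dₘₐₓ i))
  where
  open CliqueAndPath using (graph; graph-containsClique; graph-distinguishingNumber)
  dₘₐₓ : ℕ
  dₘₐₓ = max 0 (tabulate d)
  d≤dₘₐₓ : ∀ i → d i ≤ dₘₐₓ
  d≤dₘₐₓ = tabulate⁻ (xs≤max 0 (tabulate d))
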